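{- Let $G$ be a finite simple graph with no isolated vertices. Assume that $G$ is bull-free, where the bull is the graph on vertices $a,b,c,d,e$ with edges $ab,bc,ca,ad,be$. Assume further that $G$ is not isomorphic to any of the following six graphs: (1) $K_{1,3}$; (2) $K_{2,3}$; (3) $K_{3,3}$; (4) the graph obtained from $K_{1,3}$ with center $b$ and leaves $c_1,c_2,c_3$ by adding one vertex adjacent exactly to $c_2$ and $c_3$; (5) the graph obtained from $K_{1,3}$ with center $b$ and leaves $c_1,c_2,c_3$ by adding a vertex $d_1$ adjacent exactly to $c_2,c_3$ and a vertex $d_2$ adjacent exactly to $c_1,c_2$ ($d_1,d_2$ nonadjacent); (6) the graph obtained from $K_{2,3}$ with parts $\{b_1,b_2\}$ and $\{c_1,c_2,c_3\}$ by adding one vertex adjacent exactly to $c_2$ and $c_3$. Then $G$ is claw-free if and only if $G/e$ is claw-free for every edge $e\in E(G)$.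
   Context: All graphs are finite and simple. The claw is $K_{1,3}$. A graph is $H$-free if it has no induced subgraph isomorphic to $H$. For an edge $e=uv$ of $G$, the contraction $G/e$ is obtained from $G$ by deleting $u$ and $v$ and adding a new vertex adjacent to every vertex of $(N(u)\cup N(v))\setminus\{u,v\}$. -}

module Defs where

open import Data.Nat using (ℕ; zero; suc)
open import Data.Fin using (Fin; _≟_; punchIn; #_)
open import Data.Bool using (Bool; true; false; not; _∧_; _∨_; if_then_else_)
open import Data.Bool.Properties using (∨-comm)
open import Data.List using (List; []; _∷_)
open import Data.Bool.ListAction using (any)
open import Data.Product using (Σ; _×_; _,_; ∃)
open import Data.Empty using (⊥)
open import Data.Unit using (⊤)
open import Relation.Nullary using (¬_; does; yes; no)
open import Relation.Binary.PropositionalEquality using (_≡_; refl; cong)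
open import Function.Definitions using (Injective; Bijective)

record Graph (n : ℕ) : Set where
  field
    adj    : Fin n → Fin n → Bool
    sym    : ∀ i j → adj i j ≡ adj j i
    irrefl : ∀ i → adj i i ≡ false
open Graph public

E : ∀ {n} → Graph n → Fin n → Fin n → Set
E G i j = adj G i j ≡ true

mkAdj : ∀ {n} → (Fin n → Fin n → Bool) → Fin n → Fin n → Bool
mkAdj r i j = not (does (i ≟ j)) ∧ (r i j ∨ r j i)

mkAdj-sym : ∀ {n} (r : Fin n → Fin n → Bool) i j → mkAdj r i j ≡ mkAdj r j i
mkAdj-sym r i j with i ≟ j | j ≟ i
... | yes _ | yes _ = refl
... | no _ | no _ = ∨-comm (r i j) (r j i)
... | yes refl | no ¬p with () ← ¬p refl
... | no ¬p | yes refl with () ← ¬p refl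

mkAdj-irrefl : ∀ {n} (r : Fin n → Fin n → Bool) i → mkAdj r i i ≡ false
mkAdj-irrefl r i with i ≟ i
... | yes _ = refl
... | no ¬p with () ← ¬p refl

mkGraph : ∀ {n} → (Fin n → Fin n → Bool) → Graph n
mkGraph r = record { adj = mkAdj r ; sym = mkAdj-sym r ; irrefl = mkAdj-irrefl r }

_≟ᵇ_ : ∀ {n} → Fin n → Fin n → Bool
i ≟ᵇ j = does (i ≟ j)

fromEdges : ∀ {n} → List (Fin n × Fin n) → Graph n
fromEdges es = mkGraph (λ i j → any (λ { (a , b) → (a ≟ᵇ i) ∧ (b ≟ᵇ j) }) es)

InducedSub : ∀ {k n} → Graph k → Graph n → Set
InducedSub {k} {n} H G =
  Σ (Fin k → Fin n) λ f → Injective _≡_ _≡_ f × (∀ i j → adj G (f i) (f j) ≡ adj H i j)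

Free : ∀ {k n} → Graph k → Graph n → Set
Free H G = ¬ InducedSub H G

Iso : ∀ {n m} → Graph n → Graph m → Set
Iso {n} {m} G H =
  Σ (Fin n → Fin m) λ f → Bijective _≡_ _≡_ f × (∀ i j → adj H (f i) (f j) ≡ adj G i j)

NoIsolated : ∀ {n} → Graph n → Set
NoIsolated G = ∀ v → ∃ λ w → E G v w

claw : Graph 4
claw = fromEdges ((# 0 , # 1) ∷ (# 0 , # 2) ∷ (# 0 , # 3) ∷ [])

ClawFree : ∀ {n} → Graph n → Set
ClawFree G = Free claw G

-- The bull: a=0,b=1,c=2,d=3,e=4; edges ab,bc,ca,ad,be
bull : Graph 5
bull = fromEdges ((# 0 , # 1) ∷ (# 1 , # 2) ∷ (# 2 , # 0) ∷ (# 0 , # 3) ∷ (# 1 , # 4) ∷ [])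

K23 : Graph 5
K23 = fromEdges ((# 0 , # 2) ∷ (# 0 , # 3) ∷ (# 0 , # 4) ∷
                 (# 1 , # 2) ∷ (# 1 , # 3) ∷ (# 1 , # 4) ∷ [])

K33 : Graph 6
K33 = fromEdges ((# 0 , # 3) ∷ (# 0 , # 4) ∷ (# 0 , # 5) ∷
                 (# 1 , # 3) ∷ (# 1 , # 4) ∷ (# 1 , # 5) ∷
                 (# 2 , # 3) ∷ (# 2 , # 4) ∷ (# 2 , # 5) ∷ [])

-- (4): b=0, c1=1, c2=2, c3=3, d=4 adjacent to c2,c3
exc4 : Graph 5
exc4 = fromEdges ((# 0 , # 1) ∷ (# 0 , # 2) ∷ (# 0 , # 3) ∷
                  (# 4 , # 2) ∷ (# 4 , # 3) ∷ [])

-- (5): b=0, c1=1, c2=2, c3=3, d1=4 adj c2,c3; d2=5 adj c1,c2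
exc5 : Graph 6
exc5 = fromEdges ((# 0 , # 1) ∷ (# 0 , # 2) ∷ (# 0 , # 3) ∷
                  (# 4 , # 2) ∷ (# 4 , # 3) ∷
                  (# 5 , # 1) ∷ (# 5 , # 2) ∷ [])

-- (6): b1=0, b2=1, c1=2, c2=3, c3=4, d=5 adj c2,c3
exc6 : Graph 6
exc6 = fromEdges ((# 0 , # 2) ∷ (# 0 , # 3) ∷ (# 0 , # 4) ∷
                  (# 1 , # 2) ∷ (# 1 , # 3) ∷ (# 1 , # 4) ∷
                  (# 5 , # 3) ∷ (# 5 , # 4) ∷ [])

-- Vertices of G/uv are
-- Fin m, identified with V(G) ∖ {v} via punchIn v; the vertex in u's slot is the
-- merged vertex, adjacent to every vertex of (N(u) ∪ N(v)) ∖ {u,v}; all other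
-- adjacencies are as in G.
contractRel : ∀ {m} → Graph (suc m) → Fin (suc m) → Fin (suc m) → Fin m → Fin m → Bool
contractRel G u v x y =
  if punchIn v x ≟ᵇ u
  then adj G u (punchIn v y) ∨ adj G v (punchIn v y)
  else adj G (punchIn v x) (punchIn v y)

contract : ∀ {m} → Graph (suc m) → Fin (suc m) → Fin (suc m) → Graph m
contract G u v = mkGraph (contractRel G u v)

AllContractionsClawFree : ∀ {n} → Graph n → Set
AllContractionsClawFree {zero} G = ⊤
AllContractionsClawFree {suc m} G = ∀ u v → E G u v → ClawFree (contract G u v)

_⇔'_ : Set → Set → Set
A ⇔' B = (A → B) × (B → A)

-- Forward: take a claw in G/uv.  If it avoids the merged vertex it is a claw of G; if the
-- merged vertex is a leaf, the centre sees u or v, which takes its place; if it is the centre,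
-- every leaf sees u or v, and either one end of uv sees all three leaves or the leaves split
-- so as to give a claw at u, a claw at v, or a bull on a triangle through uv.
--
-- Backward: let K be a claw of G with centre c.  Contracting an edge from c or from a leaf to
-- a vertex outside K, or an edge between two outside vertices, would keep a copy of K, so the
-- outside vertices are independent, not adjacent to c, and (having a neighbour, but never a
-- single leaf neighbour) each adjacent to at least two leaves.  Two outside vertices x, y
-- share a leaf s, and the claw at s with leaves c, x, y shows that there is no third outside
-- vertex and that x and y do not miss the same leaf.  The configurations left are the six
-- exceptional graphs.

module Submission where

open import Defs hiding (sym)
open import Data.Nat using (ℕ; zero; suc; _+_; s≤s)
open import Data.Fin as Fin using (Fin; zero; suc; #_; _≟_; _<_; punchIn; punchOut)
open import Data.Fin.Properties
  using (¬Fin0; <-cmp; <⇒≢; suc-injective; punchIn-injective; punchInᵢ≢i; punchOut-cong;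
         punchOut-injective; punchIn-punchOut; any?; all?; ¬∀⟶∃¬)
open import Data.Fin.Permutation as Perm
  using (Permutation; permutation; transpose; _∘ₚ_; _⟨$⟩ʳ_; _⟨$⟩ˡ_; inverseˡ; inverseʳ)
open import Data.Bool using (Bool; true; false; not; _∨_)
import Data.Bool as Bool
open import Data.Bool.Properties using (∧-zeroʳ; ∨-idem; ∨-identityʳ; ∨-conicalˡ; ∨-conicalʳ; ¬-not)
open import Data.Product as Product using (_×_; _,_; proj₁; proj₂; ∃)
open import Data.Sum as Sum using (_⊎_; inj₁; inj₂; [_,_]′)
open import Data.Empty using (⊥; ⊥-elim)
open import Data.Unit using (tt)
open import Data.Vec.Functional using ([]; _∷_)
open import Function using (_∘_; id)
open import Function.Bundles using (Bijection)
import Function.Construct.Composition as Comp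
open import Function.Properties.Inverse using (↔⇒⤖)
open import Function.Definitions using (Injective)
open import Relation.Binary.Definitions using (tri<; tri≈; tri>)
open import Relation.Nullary using (¬_; Dec; yes; no; ¬?)
open import Relation.Nullary.Decidable using (_⊎-dec_; _×-dec_; True; toWitness; decidable-stable)
open import Relation.Binary.PropositionalEquality
  using (_≡_; _≢_; refl; sym; trans; cong; cong₂; subst; module ≡-Reasoning)

∨-duplicateʳ : ∀ x y → ((x ∨ y) ∨ x) ≡ (x ∨ y)
∨-duplicateʳ true y = refl
∨-duplicateʳ false y = ∨-identityʳ y

∨-absorbsʳ : ∀ x y → (y ≡ true → x ≡ true) → (x ∨ y) ≡ x
∨-absorbsʳ true y _ = refl
∨-absorbsʳ false true y⇒x = sym (y⇒x refl)
∨-absorbsʳ false false _ = refl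

∨≡true : ∀ {x y} → (x ∨ y) ≡ true → x ≡ true ⊎ y ≡ true
∨≡true {true} _ = inj₁ refl
∨≡true {false} y≡true = inj₂ y≡true

module _ {n} (G : Graph n) where

  E-sym : ∀ {a b} → E G a b → E G b a
  E-sym {a} {b} e = trans (Graph.sym G b a) e

  nonadjacent-sym : ∀ {a b} → adj G a b ≡ false → adj G b a ≡ false
  nonadjacent-sym {a} {b} f = trans (Graph.sym G b a) f

  E⇒≢ : ∀ {a b} → E G a b → a ≢ b
  E⇒≢ {a} e refl with () ← trans (sym e) (irrefl G a)

  nonadjacent⇒¬E : ∀ {a b} → adj G a b ≡ false → ¬ E G a b
  nonadjacent⇒¬E f e with () ← trans (sym e) f

InducedOnPairs : ∀ {k n} → Graph k → Graph n → (Fin k → Fin n) → Set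
InducedOnPairs H G f = ∀ {i j} → i < j → f i ≢ f j × adj G (f i) (f j) ≡ adj H i j

induced-by-pairs : ∀ {k n} {H : Graph k} {G : Graph n} (f : Fin k → Fin n) →
  InducedOnPairs H G f → InducedSub H G
induced-by-pairs {H = H} {G} f pair = f , injective , adjacent
  where
  injective : Injective _≡_ _≡_ f
  injective {i} {j} eq with <-cmp i j
  ... | tri< i<j _ _ = ⊥-elim (proj₁ (pair i<j) eq)
  ... | tri≈ _ i≡j _ = i≡j
  ... | tri> _ _ j<i = ⊥-elim (proj₁ (pair j<i) (sym eq))
  adjacent : ∀ i j → adj G (f i) (f j) ≡ adj H i j
  adjacent i j with <-cmp i j
  ... | tri< i<j _ _ = proj₂ (pair i<j)
  ... | tri≈ _ refl _ = trans (irrefl G (f i)) (sym (irrefl H i))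
  ... | tri> _ _ j<i = begin
    adj G (f i) (f j) ≡⟨ Graph.sym G (f i) (f j) ⟩
    adj G (f j) (f i) ≡⟨ proj₂ (pair j<i) ⟩
    adj H j i         ≡⟨ Graph.sym H j i ⟩
    adj H i j         ∎
    where open ≡-Reasoning

record Claw {n} (G : Graph n) : Set where
  field
    centre             : Fin n
    leaf               : Fin 3 → Fin n
    centre-leaf        : ∀ i → E G centre (leaf i)
    leaves-independent : ∀ i j → adj G (leaf i) (leaf j) ≡ false
    leaf-injective     : Injective _≡_ _≡_ leaf
open Claw public

claw-centre-leaf : ∀ i → adj claw zero (suc i) ≡ true
claw-centre-leaf zero = refl
claw-centre-leaf (suc zero) = refl
claw-centre-leaf (suc (suc zero)) = refl

claw-leaf-leaf : ∀ i j → adj claw (suc i) (suc j) ≡ false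
claw-leaf-leaf i j = ∧-zeroʳ _

module _ {n} {G : Graph n} where

  claw⇒induced : Claw G → InducedSub claw G
  claw⇒induced K = induced-by-pairs {H = claw} {G = G} (centre K ∷ leaf K) pair
    where
    pair : InducedOnPairs claw G (centre K ∷ leaf K)
    pair {zero} {suc i} _ =
      E⇒≢ G (centre-leaf K i) , trans (centre-leaf K i) (sym (claw-centre-leaf i))
    pair {suc i} {suc j} (s≤s i<j) =
      <⇒≢ i<j ∘ leaf-injective K , trans (leaves-independent K i j) (sym (claw-leaf-leaf i j))

  induced⇒claw : InducedSub claw G → Claw G
  induced⇒claw (f , f-injective , f-adj) = record
    { centre             = f zero
    ; leaf               = f ∘ suc
    ; centre-leaf        = λ i → trans (f-adj zero (suc i)) (claw-centre-leaf i)
    ; leaves-independent = λ i j → trans (f-adj (suc i) (suc j)) (claw-leaf-leaf i j)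
    ; leaf-injective     = suc-injective ∘ f-injective
    }

  claw-at : ∀ {c a b d} → E G c a → E G c b → E G c d →
            adj G a b ≡ false → adj G a d ≡ false → adj G b d ≡ false →
            a ≢ b → a ≢ d → b ≢ d → Claw G
  claw-at {c} {a} {b} {d} ca cb cd ab ad bd a≢b a≢d b≢d =
    induced⇒claw (induced-by-pairs {H = claw} {G = G} (c ∷ a ∷ b ∷ d ∷ []) pair)
    where
    pair : InducedOnPairs claw G (c ∷ a ∷ b ∷ d ∷ [])
    pair {zero} {suc zero} _ = E⇒≢ G ca , ca
    pair {zero} {suc (suc zero)} _ = E⇒≢ G cb , cb
    pair {zero} {suc (suc (suc zero))} _ = E⇒≢ G cd , cd
    pair {suc zero} {suc (suc zero)} _ = a≢b , ab
    pair {suc zero} {suc (suc (suc zero))} _ = a≢d , ad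
    pair {suc (suc zero)} {suc (suc (suc zero))} _ = b≢d , bd
    pair {_} {zero} ()
    pair {suc _} {suc zero} (s≤s ())
    pair {suc (suc _)} {suc (suc zero)} (s≤s (s≤s ()))
    pair {suc (suc (suc _))} {suc (suc (suc zero))} (s≤s (s≤s (s≤s ())))

  bull-at : ∀ {a b c d e} → E G a b → E G b c → E G c a → E G a d → E G b e →
            adj G a e ≡ false → adj G b d ≡ false → adj G c d ≡ false →
            adj G c e ≡ false → adj G d e ≡ false →
            a ≢ e → b ≢ d → c ≢ d → c ≢ e → d ≢ e → InducedSub bull G
  bull-at {a} {b} {c} {d} {e} ab bc ca ad be ae bd cd ce de a≢e b≢d c≢d c≢e d≢e =
    induced-by-pairs {H = bull} {G = G} (a ∷ b ∷ c ∷ d ∷ e ∷ []) pair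
    where
    pair : InducedOnPairs bull G (a ∷ b ∷ c ∷ d ∷ e ∷ [])
    pair {zero} {suc zero} _ = E⇒≢ G ab , ab
    pair {zero} {suc (suc zero)} _ = E⇒≢ G (E-sym G ca) , E-sym G ca
    pair {zero} {suc (suc (suc zero))} _ = E⇒≢ G ad , ad
    pair {zero} {suc (suc (suc (suc zero)))} _ = a≢e , ae
    pair {suc zero} {suc (suc zero)} _ = E⇒≢ G bc , bc
    pair {suc zero} {suc (suc (suc zero))} _ = b≢d , bd
    pair {suc zero} {suc (suc (suc (suc zero)))} _ = E⇒≢ G be , be
    pair {suc (suc zero)} {suc (suc (suc zero))} _ = c≢d , cd
    pair {suc (suc zero)} {suc (suc (suc (suc zero)))} _ = c≢e , ce
    pair {suc (suc (suc zero))} {suc (suc (suc (suc zero)))} _ = d≢e , de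
    pair {_} {zero} ()
    pair {suc _} {suc zero} (s≤s ())
    pair {suc (suc _)} {suc (suc zero)} (s≤s (s≤s ()))
    pair {suc (suc (suc _))} {suc (suc (suc zero))} (s≤s (s≤s (s≤s ())))
    pair {suc (suc (suc (suc _)))} {suc (suc (suc (suc zero)))} (s≤s (s≤s (s≤s (s≤s ()))))

avoid₂ : (i j : Fin 3) → ∃ λ k → k ≢ i × k ≢ j
avoid₂ zero zero = suc zero , (λ ()) , (λ ())
avoid₂ zero (suc zero) = suc (suc zero) , (λ ()) , (λ ())
avoid₂ zero (suc (suc zero)) = suc zero , (λ ()) , (λ ())
avoid₂ (suc zero) zero = suc (suc zero) , (λ ()) , (λ ())
avoid₂ (suc zero) (suc zero) = zero , (λ ()) , (λ ())
avoid₂ (suc zero) (suc (suc zero)) = zero , (λ ()) , (λ ())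
avoid₂ (suc (suc zero)) zero = suc zero , (λ ()) , (λ ())
avoid₂ (suc (suc zero)) (suc zero) = zero , (λ ()) , (λ ())
avoid₂ (suc (suc zero)) (suc (suc zero)) = zero , (λ ()) , (λ ())

module _ {n} {G : Graph n} where

  InClaw : Claw G → Fin n → Set
  InClaw K w = w ≡ centre K ⊎ ∃ λ i → w ≡ leaf K i

  Outside : Claw G → Fin n → Set
  Outside K w = ¬ InClaw K w

  inClaw? : (K : Claw G) → ∀ w → Dec (InClaw K w)
  inClaw? K w = (w ≟ centre K) ⊎-dec any? (λ i → w ≟ leaf K i)

  relabel : Permutation 3 3 → Claw G → Claw G
  relabel π K = record
    { centre             = centre K
    ; leaf               = leaf K ∘ (π ⟨$⟩ʳ_)
    ; centre-leaf        = centre-leaf K ∘ (π ⟨$⟩ʳ_)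
    ; leaves-independent = λ i j → leaves-independent K (π ⟨$⟩ʳ i) (π ⟨$⟩ʳ j)
    ; leaf-injective     = λ eq →
        trans (sym (inverseˡ π)) (trans (cong (π ⟨$⟩ˡ_) (leaf-injective K eq)) (inverseˡ π))
    }

  inClaw-relabel : ∀ π K {w} → InClaw K w → InClaw (relabel π K) w
  inClaw-relabel π K (inj₁ w≡c) = inj₁ w≡c
  inClaw-relabel π K (inj₂ (i , w≡ℓ)) = inj₂ (π ⟨$⟩ˡ i , trans w≡ℓ (cong (leaf K) (sym (inverseʳ π))))

  outside-relabel : ∀ π K {w} → Outside K w → Outside (relabel π K) w
  outside-relabel π K out (inj₁ w≡c) = out (inj₁ w≡c)
  outside-relabel π K out (inj₂ (i , w≡ℓ)) = out (inj₂ (π ⟨$⟩ʳ i , w≡ℓ))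

  outside-of-relabel : ∀ π K {w} → Outside (relabel π K) w → Outside K w
  outside-of-relabel π K out w∈K = out (inClaw-relabel π K w∈K)

-- Contraction

mkAdj-≢ : ∀ {n} (r : Fin n → Fin n → Bool) {a b} → a ≢ b → mkAdj r a b ≡ (r a b ∨ r b a)
mkAdj-≢ r {a} {b} a≢b with a ≟ b
... | yes a≡b = ⊥-elim (a≢b a≡b)
... | no _ = refl

module Contraction {m} (G : Graph (suc m)) (u v : Fin (suc m)) where

  H : Graph m
  H = contract G u v

  P : Fin m → Fin (suc m)
  P = punchIn v

  private
    rel-unmerged : ∀ {a} b → P a ≢ u → contractRel G u v a b ≡ adj G (P a) (P b)
    rel-unmerged {a} b Pa≢u with P a ≟ u
    ... | yes Pa≡u = ⊥-elim (Pa≢u Pa≡u)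
    ... | no _ = refl

    rel-merged : ∀ {a} b → P a ≡ u → contractRel G u v a b ≡ (adj G u (P b) ∨ adj G v (P b))
    rel-merged {a} b Pa≡u with P a ≟ u
    ... | yes _ = refl
    ... | no Pa≢u = ⊥-elim (Pa≢u Pa≡u)

  adj-unmerged : ∀ {a b} → P a ≢ u → P b ≢ u → adj G (P a) (P b) ≡ adj H a b
  adj-unmerged {a} {b} Pa≢u Pb≢u = by-cases (a ≟ b)
    where
    open ≡-Reasoning
    by-cases : Dec (a ≡ b) → adj G (P a) (P b) ≡ adj H a b
    by-cases (yes refl) = trans (irrefl G (P a)) (sym (irrefl H a))
    by-cases (no a≢b) = sym (begin
      adj H a b                                ≡⟨ mkAdj-≢ (contractRel G u v) a≢b ⟩
      contractRel G u v a b ∨ contractRel G u v b a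
        ≡⟨ cong₂ _∨_ (rel-unmerged b Pa≢u) (rel-unmerged a Pb≢u) ⟩
      adj G (P a) (P b) ∨ adj G (P b) (P a)    ≡⟨ cong (adj G (P a) (P b) ∨_) (Graph.sym G (P b) (P a)) ⟩
      adj G (P a) (P b) ∨ adj G (P a) (P b)    ≡⟨ ∨-idem _ ⟩
      adj G (P a) (P b)                        ∎)

  adj-merged : ∀ {a b} → a ≢ b → P a ≡ u → adj H a b ≡ (adj G u (P b) ∨ adj G v (P b))
  adj-merged {a} {b} a≢b Pa≡u = begin
    adj H a b                                           ≡⟨ mkAdj-≢ (contractRel G u v) a≢b ⟩
    contractRel G u v a b ∨ contractRel G u v b a
      ≡⟨ cong₂ _∨_ (rel-merged b Pa≡u) (rel-unmerged a Pb≢u) ⟩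
    (adj G u (P b) ∨ adj G v (P b)) ∨ adj G (P b) (P a) ≡⟨ cong ((adj G u (P b) ∨ adj G v (P b)) ∨_) Pb-u ⟩
    (adj G u (P b) ∨ adj G v (P b)) ∨ adj G u (P b)     ≡⟨ ∨-duplicateʳ (adj G u (P b)) (adj G v (P b)) ⟩
    adj G u (P b) ∨ adj G v (P b)                       ∎
    where
    open ≡-Reasoning
    Pb≢u : P b ≢ u
    Pb≢u Pb≡u = a≢b (punchIn-injective v a b (trans Pa≡u (sym Pb≡u)))
    Pb-u : adj G (P b) (P a) ≡ adj G u (P b)
    Pb-u = trans (cong (adj G (P b)) Pa≡u) (Graph.sym G (P b) u)

  adj-merged-punchOut : ∀ {s t} (v≢s : v ≢ s) (v≢t : v ≢ t) → s ≢ t → s ≡ u →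
    (E G v t → E G u t) → adj H (punchOut v≢s) (punchOut v≢t) ≡ adj G s t
  adj-merged-punchOut {s} {t} v≢s v≢t s≢t refl absorbs = begin
    adj H (punchOut v≢s) (punchOut v≢t) ≡⟨ adj-merged a≢b (punchIn-punchOut v≢s) ⟩
    adj G s (P b) ∨ adj G v (P b)       ≡⟨ cong (λ w → adj G s w ∨ adj G v w) (punchIn-punchOut v≢t) ⟩
    adj G s t ∨ adj G v t               ≡⟨ ∨-absorbsʳ (adj G s t) (adj G v t) absorbs ⟩
    adj G s t                           ∎
    where
    open ≡-Reasoning
    b = punchOut v≢t
    a≢b : punchOut v≢s ≢ b
    a≢b eq = s≢t (trans (sym (punchIn-punchOut v≢s)) (trans (cong P eq) (punchIn-punchOut v≢t)))

  adj-punchOut : ∀ {s t} (v≢s : v ≢ s) (v≢t : v ≢ t) →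
    (s ≡ u → t ≢ u → E G v t → E G u t) → (t ≡ u → s ≢ u → E G v s → E G u s) →
    adj H (punchOut v≢s) (punchOut v≢t) ≡ adj G s t
  adj-punchOut {s} {t} v≢s v≢t s-absorbs t-absorbs = by-cases (s ≟ t) (s ≟ u) (t ≟ u)
    where
    by-cases : Dec (s ≡ t) → Dec (s ≡ u) → Dec (t ≡ u) → adj H (punchOut v≢s) (punchOut v≢t) ≡ adj G s t
    by-cases (yes refl) _ _ = begin
      adj H (punchOut v≢s) (punchOut v≢t) ≡⟨ cong (adj H (punchOut v≢s)) (punchOut-cong v refl) ⟩
      adj H (punchOut v≢s) (punchOut v≢s) ≡⟨ irrefl H _ ⟩
      false                               ≡⟨ sym (irrefl G s) ⟩
      adj G s s                           ∎
      where open ≡-Reasoning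
    by-cases (no s≢t) (yes s≡u) _ =
      adj-merged-punchOut v≢s v≢t s≢t s≡u (s-absorbs s≡u (λ t≡u → s≢t (trans s≡u (sym t≡u))))
    by-cases (no s≢t) (no s≢u) (yes t≡u) = begin
      adj H (punchOut v≢s) (punchOut v≢t) ≡⟨ Graph.sym H _ _ ⟩
      adj H (punchOut v≢t) (punchOut v≢s)
        ≡⟨ adj-merged-punchOut v≢t v≢s (s≢t ∘ sym) t≡u (t-absorbs t≡u s≢u) ⟩
      adj G t s                           ≡⟨ Graph.sym G t s ⟩
      adj G s t                           ∎
      where open ≡-Reasoning
    by-cases (no _) (no s≢u) (no t≢u) = begin
      adj H (punchOut v≢s) (punchOut v≢t)
        ≡⟨ sym (adj-unmerged (s≢u ∘ trans (sym Ps≡s)) (t≢u ∘ trans (sym Pt≡t))) ⟩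
      adj G (P (punchOut v≢s)) (P (punchOut v≢t)) ≡⟨ cong₂ (adj G) Ps≡s Pt≡t ⟩
      adj G s t                               ∎
      where
      open ≡-Reasoning
      Ps≡s = punchIn-punchOut v≢s
      Pt≡t = punchIn-punchOut v≢t

  -- The hypothesis says that merging v into u creates no new edge inside K.
  claw-survives : (K : Claw G) → Outside K v →
    (InClaw K u → ∀ {t} → InClaw K t → t ≢ u → E G v t → E G u t) → Claw H
  claw-survives K v-out absorbs = record
    { centre             = punchOut (v≢ (inj₁ refl))
    ; leaf               = λ i → punchOut (v≢ (inj₂ (i , refl)))
    ; centre-leaf        = λ i → trans (adj-K (inj₁ refl) (inj₂ (i , refl))) (centre-leaf K i)
    ; leaves-independent = λ i j → trans (adj-K (inj₂ (i , refl)) (inj₂ (j , refl)))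
                                         (leaves-independent K i j)
    ; leaf-injective     = λ eq →
        leaf-injective K (punchOut-injective (v≢ (inj₂ (_ , refl))) (v≢ (inj₂ (_ , refl))) eq)
    }
    where
    v≢ : ∀ {t} → InClaw K t → v ≢ t
    v≢ t∈K refl = v-out t∈K
    adj-K : ∀ {s t} (s∈K : InClaw K s) (t∈K : InClaw K t) →
            adj H (punchOut (v≢ s∈K)) (punchOut (v≢ t∈K)) ≡ adj G s t
    adj-K s∈K t∈K = adj-punchOut (v≢ s∈K) (v≢ t∈K)
      (λ { refl → absorbs s∈K t∈K }) (λ { refl → absorbs t∈K s∈K })

-- Claws in contractions of claw-free bull-free graphs

module _ {n} {G : Graph n} {u v : Fin n} (uv : E G u v) where

  -- If neither end of uv sees the whole triple, some qᵢ sees only v and some qⱼ only u;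
  -- the third vertex then completes a claw at u, a claw at v, or a bull on the triangle u v qₖ.
  claw-or-bull-at-edge : (q : Fin 3 → Fin n) → Injective _≡_ _≡_ q →
    (∀ i j → adj G (q i) (q j) ≡ false) → (∀ i → q i ≢ u) → (∀ i → q i ≢ v) →
    (∀ i → (adj G u (q i) ∨ adj G v (q i)) ≡ true) → Claw G ⊎ InducedSub bull G
  claw-or-bull-at-edge q q-injective independent q≢u q≢v dominated
    with all? (λ i → adj G u (q i) Bool.≟ true) | all? (λ i → adj G v (q i) Bool.≟ true)
  ... | yes u-sees-all | _ = inj₁ (record
    { centre = u ; leaf = q ; centre-leaf = u-sees-all
    ; leaves-independent = independent ; leaf-injective = q-injective })
  ... | no _ | yes v-sees-all = inj₁ (record
    { centre = v ; leaf = q ; centre-leaf = v-sees-all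
    ; leaves-independent = independent ; leaf-injective = q-injective })
  ... | no ¬u-sees-all | no ¬v-sees-all =
    mixed (¬∀⟶∃¬ 3 _ (λ i → adj G u (q i) Bool.≟ true) ¬u-sees-all)
          (¬∀⟶∃¬ 3 _ (λ j → adj G v (q j) Bool.≟ true) ¬v-sees-all)
    where
    only-v : ∀ {i} → ¬ E G u (q i) → E G v (q i)
    only-v {i} ¬ui with ∨≡true (dominated i)
    ... | inj₁ ui = ⊥-elim (¬ui ui)
    ... | inj₂ vi = vi
    only-u : ∀ {j} → ¬ E G v (q j) → E G u (q j)
    only-u {j} ¬vj with ∨≡true (dominated j)
    ... | inj₁ uj = uj
    ... | inj₂ vj = ⊥-elim (¬vj vj)
    q-≢ : ∀ {i j} → i ≢ j → q i ≢ q j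
    q-≢ i≢j = i≢j ∘ q-injective
    mixed : (∃ λ i → ¬ E G u (q i)) → (∃ λ j → ¬ E G v (q j)) → Claw G ⊎ InducedSub bull G
    mixed (i , ¬ui) (j , ¬vj) = third (adj G u (q k) Bool.≟ true) (adj G v (q k) Bool.≟ true)
      where
      k = proj₁ (avoid₂ i j)
      k≢i = proj₁ (proj₂ (avoid₂ i j))
      k≢j = proj₂ (proj₂ (avoid₂ i j))
      j≢i : j ≢ i
      j≢i refl = ¬vj (only-v ¬ui)
      third : Dec (E G u (q k)) → Dec (E G v (q k)) → Claw G ⊎ InducedSub bull G
      third (yes uk) (yes vk) = inj₂ (bull-at {G = G} uv vk (E-sym G uk) (only-u ¬vj) (only-v ¬ui)
        (¬-not ¬ui) (¬-not ¬vj) (independent k j) (independent k i) (independent j i)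
        (q≢u i ∘ sym) (q≢v j ∘ sym) (q-≢ k≢j) (q-≢ k≢i) (q-≢ j≢i))
      third (yes uk) (no ¬vk) = inj₁ (claw-at uv (only-u ¬vj) uk (¬-not ¬vj) (¬-not ¬vk)
        (independent j k) (q≢v j ∘ sym) (q≢v k ∘ sym) (q-≢ (k≢j ∘ sym)))
      third (no ¬uk) (yes vk) = inj₁ (claw-at (E-sym G uv) (only-v ¬ui) vk (¬-not ¬ui) (¬-not ¬uk)
        (independent i k) (q≢u i ∘ sym) (q≢u k ∘ sym) (q-≢ (k≢i ∘ sym)))
      third (no ¬uk) (no ¬vk) = ⊥-elim (¬vk (only-v ¬uk))

module Forward {m} {G : Graph (suc m)} {u v : Fin (suc m)} (uv : E G u v) where
  open Contraction G u v

  P-injective : ∀ {a b} → P a ≡ P b → a ≡ b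
  P-injective = punchIn-injective v _ _

  P≢v : ∀ a → P a ≢ v
  P≢v = punchInᵢ≢i v

  lift-claw : (K : Claw H) → P (centre K) ≢ u → (∀ i → P (leaf K i) ≢ u) → Claw G
  lift-claw K c≢u ℓ≢u = record
    { centre             = P (centre K)
    ; leaf               = P ∘ leaf K
    ; centre-leaf        = λ i → trans (adj-unmerged c≢u (ℓ≢u i)) (centre-leaf K i)
    ; leaves-independent = λ i j → trans (adj-unmerged (ℓ≢u i) (ℓ≢u j)) (leaves-independent K i j)
    ; leaf-injective     = leaf-injective K ∘ P-injective
    }

  -- The centre sees the merged leaf, so it sees u or v; that vertex replaces the merged leaf.
  claw-of-merged-leaf : (K : Claw H) → P (leaf K zero) ≡ u → Claw G
  claw-of-merged-leaf K merged = [ via-u , via-v ]′ (∨≡true centre-sees-merged)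
    where
    c = P (centre K)
    q : Fin 3 → Fin (suc m)
    q = P ∘ leaf K
    ℓ≢u : ∀ {i} → i ≢ zero → q i ≢ u
    ℓ≢u i≢0 eq = i≢0 (leaf-injective K (P-injective (trans eq (sym merged))))
    c≢u : c ≢ u
    c≢u eq = E⇒≢ H (centre-leaf K zero) (P-injective (trans eq (sym merged)))
    centre-sees-merged : (adj G u c ∨ adj G v c) ≡ true
    centre-sees-merged = trans (sym (adj-merged (E⇒≢ H (E-sym H (centre-leaf K zero))) merged))
                               (E-sym H (centre-leaf K zero))
    misses : ∀ {i} → i ≢ zero → (adj G u (q i) ∨ adj G v (q i)) ≡ false
    misses i≢0 = trans (sym (adj-merged (i≢0 ∘ sym ∘ leaf-injective K) merged))
                       (leaves-independent K zero _)
    sees : ∀ {i} → i ≢ zero → E G c (q i)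
    sees i≢0 = trans (adj-unmerged c≢u (ℓ≢u i≢0)) (centre-leaf K _)
    via : ∀ {w} → E G c w → adj G w (q (suc zero)) ≡ false → adj G w (q (suc (suc zero))) ≡ false →
          w ≢ q (suc zero) → w ≢ q (suc (suc zero)) → Claw G
    via cw w₁ w₂ w≢₁ w≢₂ = claw-at cw (sees (λ ())) (sees (λ ())) w₁ w₂
      (trans (adj-unmerged (ℓ≢u (λ ())) (ℓ≢u (λ ()))) (leaves-independent K _ _)) w≢₁ w≢₂
      (λ eq → 1≢2 (leaf-injective K (P-injective eq)))
      where
      1≢2 : Fin.suc {2} zero ≢ suc (suc zero)
      1≢2 ()
    via-u : E G u c → Claw G
    via-u uc = via (E-sym G uc) (∨-conicalˡ _ _ (misses (λ ()))) (∨-conicalˡ _ _ (misses (λ ())))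
                   (ℓ≢u (λ ()) ∘ sym) (ℓ≢u (λ ()) ∘ sym)
    via-v : E G v c → Claw G
    via-v vc = via (E-sym G vc) (∨-conicalʳ _ _ (misses (λ ()))) (∨-conicalʳ _ _ (misses (λ ())))
                   (P≢v _ ∘ sym) (P≢v _ ∘ sym)

  claw-or-bull-of-merged-centre : (K : Claw H) → P (centre K) ≡ u → Claw G ⊎ InducedSub bull G
  claw-or-bull-of-merged-centre K merged =
    claw-or-bull-at-edge uv (P ∘ leaf K) (leaf-injective K ∘ P-injective)
      (λ i j → trans (adj-unmerged (ℓ≢u i) (ℓ≢u j)) (leaves-independent K i j))
      ℓ≢u (P≢v ∘ leaf K)
      (λ i → trans (sym (adj-merged (E⇒≢ H (centre-leaf K i)) merged)) (centre-leaf K i))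
    where
    ℓ≢u : ∀ i → P (leaf K i) ≢ u
    ℓ≢u i eq = E⇒≢ H (centre-leaf K i) (P-injective (trans merged (sym eq)))

  claw-or-bull-of-contraction : Claw H → Claw G ⊎ InducedSub bull G
  claw-or-bull-of-contraction K with P (centre K) ≟ u | any? (λ i → P (leaf K i) ≟ u)
  ... | yes merged | _ = claw-or-bull-of-merged-centre K merged
  ... | no c≢u | yes (i , merged) = inj₁ (claw-of-merged-leaf (relabel (transpose zero i) K) merged)
  ... | no c≢u | no none = inj₁ (lift-claw K c≢u (λ i eq → none (i , eq)))

contraction-claw-free : ∀ {m} {G : Graph (suc m)} → ClawFree G → Free bull G →
  AllContractionsClawFree G
contraction-claw-free {G = G} claw-free bull-free u v uv K =
  [ claw-free ∘ claw⇒induced , bull-free ]′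
    (Forward.claw-or-bull-of-contraction {G = G} {u} {v} uv (induced⇒claw K))

-- Isomorphisms with extended claws

module _ {n k} {G : Graph n} {A : Graph k} where

  iso-of-permutation : (π : Permutation n k) →
    (∀ i j → adj A (π ⟨$⟩ʳ i) (π ⟨$⟩ʳ j) ≡ adj G i j) → Iso G A
  iso-of-permutation π π-adj = (π ⟨$⟩ʳ_) , Bijection.bijective (↔⇒⤖ π) , π-adj

  iso-of-enumeration : (e : Fin k → Fin n) → Injective _≡_ _≡_ e → (∀ w → ∃ λ i → e i ≡ w) →
    (∀ i j → adj G (e i) (e j) ≡ adj A i j) → Iso G A
  iso-of-enumeration e e-injective e-covers e-adj =
    iso-of-permutation (permutation index e index-e e-index) index-adj
    where
    index : Fin n → Fin k
    index w = proj₁ (e-covers w)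
    e-index : ∀ w → e (index w) ≡ w
    e-index w = proj₂ (e-covers w)
    index-e : ∀ i → index (e i) ≡ i
    index-e i = e-injective (e-index (e i))
    index-adj : ∀ v w → adj A (index v) (index w) ≡ adj G v w
    index-adj v w = trans (sym (e-adj (index v) (index w))) (cong₂ (adj G) (e-index v) (e-index w))

iso-trans : ∀ {n k l} {G : Graph n} {A : Graph k} {B : Graph l} → Iso G A → Iso A B → Iso G B
iso-trans (f , f-bijective , f-adj) (g , g-bijective , g-adj) =
  g ∘ f , Comp.bijective _≡_ _≡_ _≡_ f-bijective g-bijective ,
  λ i j → trans (g-adj (f i) (f j)) (f-adj i j)

-- The ⊤-valued implicit arguments are filled in by evaluation, so for closed graphs the
-- table is checked by computation.
iso-by-table : ∀ {k} (A B : Graph k) (f g : Fin k → Fin k) →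
  {_ : True (all? λ i → g (f i) ≟ i)} → {_ : True (all? λ i → f (g i) ≟ i)} →
  {_ : True (all? λ i → all? λ j → adj B (f i) (f j) Bool.≟ adj A i j)} → Iso A B
iso-by-table A B f g {g∘f} {f∘g} {f-adj} = iso-of-permutation {G = A} {A = B}
  (permutation f g (toWitness f∘g) (toWitness g∘f)) (λ i j → toWitness f-adj i j)

single-injective : ∀ {n} {a : Fin n} → Injective _≡_ _≡_ (a ∷ [])
single-injective {x = zero} {y = zero} _ = refl

pair-injective : ∀ {n} {a b : Fin n} → a ≢ b → Injective _≡_ _≡_ (a ∷ b ∷ [])
pair-injective a≢b {zero} {zero} _ = refl
pair-injective a≢b {zero} {suc zero} x≡y = ⊥-elim (a≢b x≡y)
pair-injective a≢b {suc zero} {zero} y≡x = ⊥-elim (a≢b (sym y≡x))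
pair-injective a≢b {suc zero} {suc zero} _ = refl

data Slot (p : ℕ) : Set where
  centreₛ : Slot p
  leafₛ   : Fin 3 → Slot p
  extraₛ  : Fin p → Slot p

slot : ∀ {p} → Fin (4 + p) → Slot p
slot zero = centreₛ
slot (suc zero) = leafₛ zero
slot (suc (suc zero)) = leafₛ (suc zero)
slot (suc (suc (suc zero))) = leafₛ (suc (suc zero))
slot (suc (suc (suc (suc j)))) = extraₛ j

unslot : ∀ {p} → Slot p → Fin (4 + p)
unslot centreₛ = zero
unslot (leafₛ zero) = suc zero
unslot (leafₛ (suc zero)) = suc (suc zero)
unslot (leafₛ (suc (suc zero))) = suc (suc (suc zero))
unslot (extraₛ j) = suc (suc (suc (suc j)))

slot-unslot : ∀ {p} (s : Slot p) → slot (unslot s) ≡ s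
slot-unslot centreₛ = refl
slot-unslot (leafₛ zero) = refl
slot-unslot (leafₛ (suc zero)) = refl
slot-unslot (leafₛ (suc (suc zero))) = refl
slot-unslot (extraₛ j) = refl

unslot-slot : ∀ {p} (i : Fin (4 + p)) → unslot (slot i) ≡ i
unslot-slot zero = refl
unslot-slot (suc zero) = refl
unslot-slot (suc (suc zero)) = refl
unslot-slot (suc (suc (suc zero))) = refl
unslot-slot (suc (suc (suc (suc j)))) = refl

slotAdj : ∀ {p} → (Fin p → Fin 3 → Bool) → Slot p → Slot p → Bool
slotAdj N centreₛ (leafₛ _) = true
slotAdj N (leafₛ _) centreₛ = true
slotAdj N (leafₛ i) (extraₛ j) = N j i
slotAdj N (extraₛ j) (leafₛ i) = N j i
slotAdj N centreₛ centreₛ = false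
slotAdj N centreₛ (extraₛ _) = false
slotAdj N (leafₛ _) (leafₛ _) = false
slotAdj N (extraₛ _) centreₛ = false
slotAdj N (extraₛ _) (extraₛ _) = false

slotAdj-sym : ∀ {p} (N : Fin p → Fin 3 → Bool) s t → slotAdj N s t ≡ slotAdj N t s
slotAdj-sym N centreₛ centreₛ = refl
slotAdj-sym N centreₛ (leafₛ _) = refl
slotAdj-sym N centreₛ (extraₛ _) = refl
slotAdj-sym N (leafₛ _) centreₛ = refl
slotAdj-sym N (leafₛ _) (leafₛ _) = refl
slotAdj-sym N (leafₛ _) (extraₛ _) = refl
slotAdj-sym N (extraₛ _) centreₛ = refl
slotAdj-sym N (extraₛ _) (leafₛ _) = refl
slotAdj-sym N (extraₛ _) (extraₛ _) = refl

slotAdj-irrefl : ∀ {p} (N : Fin p → Fin 3 → Bool) s → slotAdj N s s ≡ false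
slotAdj-irrefl N centreₛ = refl
slotAdj-irrefl N (leafₛ _) = refl
slotAdj-irrefl N (extraₛ _) = refl

-- A claw with centre 0 and leaves 1, 2, 3, plus independent vertices 4 + j (j < p) not
-- adjacent to the centre, where 4 + j is adjacent to leaf 1 + i exactly when N j i.
extendedClaw : ∀ {p} → (Fin p → Fin 3 → Bool) → Graph (4 + p)
extendedClaw N = record
  { adj    = λ i j → slotAdj N (slot i) (slot j)
  ; sym    = λ i j → slotAdj-sym N (slot i) (slot j)
  ; irrefl = λ i → slotAdj-irrefl N (slot i)
  }

everyLeaf : Fin 3 → Bool
everyLeaf _ = true

allLeavesBut : Fin 3 → Fin 3 → Bool
allLeavesBut i t = not (t ≟ᵇ i)

claw≅ : Iso (extendedClaw []) claw
claw≅ = iso-by-table (extendedClaw []) claw id id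

K23≅ : Iso (extendedClaw (everyLeaf ∷ [])) K23
K23≅ = iso-by-table (extendedClaw (everyLeaf ∷ [])) K23
  (# 0 ∷ # 2 ∷ # 3 ∷ # 4 ∷ # 1 ∷ [])
  (# 0 ∷ # 4 ∷ # 1 ∷ # 2 ∷ # 3 ∷ [])

K33≅ : Iso (extendedClaw (everyLeaf ∷ everyLeaf ∷ [])) K33
K33≅ = iso-by-table (extendedClaw (everyLeaf ∷ everyLeaf ∷ [])) K33
  (# 0 ∷ # 3 ∷ # 4 ∷ # 5 ∷ # 1 ∷ # 2 ∷ [])
  (# 0 ∷ # 4 ∷ # 5 ∷ # 1 ∷ # 2 ∷ # 3 ∷ [])

exc4≅ : Iso (extendedClaw (allLeavesBut zero ∷ [])) exc4
exc4≅ = iso-by-table (extendedClaw (allLeavesBut zero ∷ [])) exc4 id id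

exc5≅ : Iso (extendedClaw (allLeavesBut zero ∷ allLeavesBut (# 2) ∷ [])) exc5
exc5≅ = iso-by-table (extendedClaw (allLeavesBut zero ∷ allLeavesBut (# 2) ∷ [])) exc5 id id

exc6≅ : Iso (extendedClaw (everyLeaf ∷ allLeavesBut zero ∷ [])) exc6
exc6≅ = iso-by-table (extendedClaw (everyLeaf ∷ allLeavesBut zero ∷ [])) exc6
  (# 0 ∷ # 2 ∷ # 3 ∷ # 4 ∷ # 1 ∷ # 5 ∷ [])
  (# 0 ∷ # 4 ∷ # 1 ∷ # 2 ∷ # 3 ∷ # 5 ∷ [])

data Exceptional {n} (G : Graph n) : Set where
  is-claw : Iso G claw → Exceptional G
  is-K23  : Iso G K23  → Exceptional G
  is-K33  : Iso G K33  → Exceptional G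
  is-exc4 : Iso G exc4 → Exceptional G
  is-exc5 : Iso G exc5 → Exceptional G
  is-exc6 : Iso G exc6 → Exceptional G

permutation-sending : (i j : Fin 3) → i ≢ j →
  ∃ λ (π : Permutation 3 3) → π ⟨$⟩ʳ zero ≡ i × π ⟨$⟩ʳ # 2 ≡ j
permutation-sending zero zero 0≢0 = ⊥-elim (0≢0 refl)
permutation-sending zero (suc zero) _ = transpose (# 1) (# 2) , refl , refl
permutation-sending zero (suc (suc zero)) _ = Perm.id , refl , refl
permutation-sending (suc zero) zero _ =
  transpose (# 0) (# 2) ∘ₚ transpose (# 1) (# 2) , refl , refl
permutation-sending (suc zero) (suc zero) 1≢1 = ⊥-elim (1≢1 refl)
permutation-sending (suc zero) (suc (suc zero)) _ = transpose (# 0) (# 1) , refl , refl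
permutation-sending (suc (suc zero)) zero _ = transpose (# 0) (# 2) , refl , refl
permutation-sending (suc (suc zero)) (suc zero) _ =
  transpose (# 0) (# 2) ∘ₚ transpose (# 0) (# 1) , refl , refl
permutation-sending (suc (suc zero)) (suc (suc zero)) 2≢2 = ⊥-elim (2≢2 refl)

-- Graphs all of whose contractions are claw-free

module Backward {m} {G : Graph (suc m)} (no-isolated : NoIsolated G)
  (contractions-claw-free : ∀ u v → E G u v → ClawFree (contract G u v)) where

  no-claw-in-contraction : ∀ {u v} → E G u v → ¬ Claw (contract G u v)
  no-claw-in-contraction {u} {v} uv K = contractions-claw-free u v uv (claw⇒induced K)

  module _ (K : Claw G) where

    outside-centre-nonadjacent : ∀ {x} → Outside K x → adj G x (centre K) ≡ false
    outside-centre-nonadjacent {x} x-out = ¬-not λ xc →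
      no-claw-in-contraction (E-sym G xc) (Contraction.claw-survives G (centre K) x K x-out absorbs)
      where
      absorbs : InClaw K (centre K) → ∀ {t} → InClaw K t → t ≢ centre K → E G x t → E G (centre K) t
      absorbs _ (inj₁ t≡c) t≢c _ = ⊥-elim (t≢c t≡c)
      absorbs _ (inj₂ (i , refl)) _ _ = centre-leaf K i

    outsiders-nonadjacent : ∀ {x y} → Outside K x → Outside K y → adj G x y ≡ false
    outsiders-nonadjacent {x} {y} x-out y-out = ¬-not λ xy →
      no-claw-in-contraction xy (Contraction.claw-survives G x y K y-out (⊥-elim ∘ x-out))

    outsider-has-second-leaf : ∀ {x i} → Outside K x → E G x (leaf K i) →
      ¬ (∀ j → j ≢ i → adj G x (leaf K j) ≡ false)
    outsider-has-second-leaf {x} {i} x-out xi only-i =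
      no-claw-in-contraction (E-sym G xi) (Contraction.claw-survives G (leaf K i) x K x-out absorbs)
      where
      absorbs : InClaw K (leaf K i) → ∀ {t} → InClaw K t → t ≢ leaf K i → E G x t → E G (leaf K i) t
      absorbs _ (inj₁ refl) _ _ = E-sym G (centre-leaf K i)
      absorbs _ (inj₂ (j , refl)) t≢ℓ xj =
        ⊥-elim (nonadjacent⇒¬E G (only-i j (t≢ℓ ∘ cong (leaf K))) xj)

    outsider-has-leaf : ∀ {x} → Outside K x → ∃ λ i → E G x (leaf K i)
    outsider-has-leaf {x} x-out with no-isolated x
    ... | w , xw with inClaw? K w
    ...   | yes (inj₁ refl) = ⊥-elim (nonadjacent⇒¬E G (outside-centre-nonadjacent x-out) xw)
    ...   | yes (inj₂ (i , refl)) = i , xw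
    ...   | no w-out = ⊥-elim (nonadjacent⇒¬E G (outsiders-nonadjacent x-out w-out) xw)

    outsider-misses-at-most-one : ∀ {x} → Outside K x → ∃ λ i → ∀ j → j ≢ i → E G x (leaf K j)
    outsider-misses-at-most-one {x} x-out
      with adj G x (leaf K zero) in x₀ | adj G x (leaf K (suc zero)) in x₁
         | adj G x (leaf K (suc (suc zero))) in x₂
    ... | true | true | true = zero , λ
      { zero _ → x₀ ; (suc zero) _ → x₁ ; (suc (suc zero)) _ → x₂ }
    ... | false | true | true = zero , λ
      { zero 0≢0 → ⊥-elim (0≢0 refl) ; (suc zero) _ → x₁ ; (suc (suc zero)) _ → x₂ }
    ... | true | false | true = suc zero , λ
      { zero _ → x₀ ; (suc zero) 1≢1 → ⊥-elim (1≢1 refl) ; (suc (suc zero)) _ → x₂ }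
    ... | true | true | false = suc (suc zero) , λ
      { zero _ → x₀ ; (suc zero) _ → x₁ ; (suc (suc zero)) 2≢2 → ⊥-elim (2≢2 refl) }
    ... | true | false | false = ⊥-elim (outsider-has-second-leaf x-out x₀ λ
      { zero 0≢0 → ⊥-elim (0≢0 refl) ; (suc zero) _ → x₁ ; (suc (suc zero)) _ → x₂ })
    ... | false | true | false = ⊥-elim (outsider-has-second-leaf x-out x₁ λ
      { zero _ → x₀ ; (suc zero) 1≢1 → ⊥-elim (1≢1 refl) ; (suc (suc zero)) _ → x₂ })
    ... | false | false | true = ⊥-elim (outsider-has-second-leaf x-out x₂ λ
      { zero _ → x₀ ; (suc zero) _ → x₁ ; (suc (suc zero)) 2≢2 → ⊥-elim (2≢2 refl) })
    ... | false | false | false with outsider-has-leaf x-out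
    ...   | zero , xℓ = ⊥-elim (nonadjacent⇒¬E G x₀ xℓ)
    ...   | suc zero , xℓ = ⊥-elim (nonadjacent⇒¬E G x₁ xℓ)
    ...   | suc (suc zero) , xℓ = ⊥-elim (nonadjacent⇒¬E G x₂ xℓ)

    outsider-misses-only : ∀ {x i} → Outside K x → adj G x (leaf K i) ≡ false →
      ∀ j → j ≢ i → E G x (leaf K j)
    outsider-misses-only {x} {i} x-out xi with outsider-misses-at-most-one x-out
    ... | i′ , sees with i ≟ i′
    ...   | yes refl = sees
    ...   | no i≢i′ = ⊥-elim (nonadjacent⇒¬E G xi (sees i i≢i′))

    common-leaf : ∀ {x y} → Outside K x → Outside K y → ∃ λ s → E G x (leaf K s) × E G y (leaf K s)
    common-leaf x-out y-out with outsider-misses-at-most-one x-out | outsider-misses-at-most-one y-out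
    ... | i , x-sees | j , y-sees with avoid₂ i j
    ...   | s , s≢i , s≢j = s , x-sees s s≢i , y-sees s s≢j

    claw-at-leaf : ∀ {x y s} → Outside K x → Outside K y → x ≢ y →
      E G x (leaf K s) → E G y (leaf K s) → Claw G
    claw-at-leaf x-out y-out x≢y xs ys = claw-at (E-sym G (centre-leaf K _)) (E-sym G xs) (E-sym G ys)
      (nonadjacent-sym G (outside-centre-nonadjacent x-out))
      (nonadjacent-sym G (outside-centre-nonadjacent y-out))
      (outsiders-nonadjacent x-out y-out)
      (λ c≡x → x-out (inj₁ (sym c≡x))) (λ c≡y → y-out (inj₁ (sym c≡y))) x≢y

  -- A third outsider z would lie outside the claw at a common leaf of x and y with leaves
  -- centre, x, y, yet be adjacent to none of these.
  at-most-two-outsiders : (K : Claw G) → ∀ {x y z} → Outside K x → Outside K y → Outside K z →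
    x ≢ y → z ≢ x → z ≢ y → ⊥
  at-most-two-outsiders K {x} {y} {z} x-out y-out z-out x≢y z≢x z≢y with common-leaf K x-out y-out
  ... | s , xs , ys = z-isolated-in-K′ (outsider-has-leaf K′ z-out′)
    where
    K′ = claw-at-leaf K x-out y-out x≢y xs ys
    z-out′ : Outside K′ z
    z-out′ (inj₁ z≡ℓ) = z-out (inj₂ (s , z≡ℓ))
    z-out′ (inj₂ (zero , z≡c)) = z-out (inj₁ z≡c)
    z-out′ (inj₂ (suc zero , z≡x)) = z≢x z≡x
    z-out′ (inj₂ (suc (suc zero) , z≡y)) = z≢y z≡y
    z-isolated-in-K′ : ¬ (∃ λ t → E G z (leaf K′ t))
    z-isolated-in-K′ (zero , zc) = nonadjacent⇒¬E G (outside-centre-nonadjacent K z-out) zc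
    z-isolated-in-K′ (suc zero , zx) = nonadjacent⇒¬E G (outsiders-nonadjacent K z-out x-out) zx
    z-isolated-in-K′ (suc (suc zero) , zy) = nonadjacent⇒¬E G (outsiders-nonadjacent K z-out y-out) zy

  -- If x and y both miss leaf i, the claw at another leaf s with leaves centre, x, y
  -- meets leaf i outside, adjacent to its leaf centre only.
  no-common-miss : (K : Claw G) → ∀ {x y i} → Outside K x → Outside K y → x ≢ y →
    adj G x (leaf K i) ≡ false → adj G y (leaf K i) ≡ false → ⊥
  no-common-miss K {x} {y} {i} x-out y-out x≢y xi yi =
    outsider-has-second-leaf K′ ℓ-out (E-sym G (centre-leaf K i)) λ
      { zero 0≢0 → ⊥-elim (0≢0 refl)
      ; (suc zero) _ → nonadjacent-sym G xi
      ; (suc (suc zero)) _ → nonadjacent-sym G yi }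
    where
    s = proj₁ (avoid₂ i i)
    s≢i = proj₁ (proj₂ (avoid₂ i i))
    K′ = claw-at-leaf K x-out y-out x≢y (outsider-misses-only K x-out xi s s≢i)
                                        (outsider-misses-only K y-out yi s s≢i)
    ℓ-out : Outside K′ (leaf K i)
    ℓ-out (inj₁ ℓ≡ℓ) = s≢i (sym (leaf-injective K ℓ≡ℓ))
    ℓ-out (inj₂ (zero , ℓ≡c)) = E⇒≢ G (centre-leaf K i) (sym ℓ≡c)
    ℓ-out (inj₂ (suc zero , ℓ≡x)) = x-out (inj₂ (i , sym ℓ≡x))
    ℓ-out (inj₂ (suc (suc zero) , ℓ≡y)) = y-out (inj₂ (i , sym ℓ≡y))

  module _ (K : Claw G) {p} (extra : Fin p → Fin (suc m))
           (extra-injective : Injective _≡_ _≡_ extra) (extra-outside : ∀ j → Outside K (extra j)) where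

    vertex : Slot p → Fin (suc m)
    vertex centreₛ = centre K
    vertex (leafₛ i) = leaf K i
    vertex (extraₛ j) = extra j

    vertex-injective : ∀ {s t} → vertex s ≡ vertex t → s ≡ t
    vertex-injective {centreₛ} {centreₛ} _ = refl
    vertex-injective {centreₛ} {leafₛ i} c≡ℓ = ⊥-elim (E⇒≢ G (centre-leaf K i) c≡ℓ)
    vertex-injective {centreₛ} {extraₛ j} c≡x = ⊥-elim (extra-outside j (inj₁ (sym c≡x)))
    vertex-injective {leafₛ i} {centreₛ} ℓ≡c = ⊥-elim (E⇒≢ G (centre-leaf K i) (sym ℓ≡c))
    vertex-injective {leafₛ i} {leafₛ j} ℓ≡ℓ = cong leafₛ (leaf-injective K ℓ≡ℓ)
    vertex-injective {leafₛ i} {extraₛ j} ℓ≡x = ⊥-elim (extra-outside j (inj₂ (i , sym ℓ≡x)))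
    vertex-injective {extraₛ j} {centreₛ} x≡c = ⊥-elim (extra-outside j (inj₁ x≡c))
    vertex-injective {extraₛ j} {leafₛ i} x≡ℓ = ⊥-elim (extra-outside j (inj₂ (i , x≡ℓ)))
    vertex-injective {extraₛ j} {extraₛ k} x≡x = cong extraₛ (extra-injective x≡x)

    vertex-adj : (N : Fin p → Fin 3 → Bool) → (∀ j i → adj G (extra j) (leaf K i) ≡ N j i) →
      ∀ s t → adj G (vertex s) (vertex t) ≡ slotAdj N s t
    vertex-adj N rows centreₛ centreₛ = irrefl G (centre K)
    vertex-adj N rows centreₛ (leafₛ i) = centre-leaf K i
    vertex-adj N rows centreₛ (extraₛ j) =
      nonadjacent-sym G (outside-centre-nonadjacent K (extra-outside j))
    vertex-adj N rows (leafₛ i) centreₛ = E-sym G (centre-leaf K i)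
    vertex-adj N rows (leafₛ i) (leafₛ j) = leaves-independent K i j
    vertex-adj N rows (leafₛ i) (extraₛ j) = trans (Graph.sym G (leaf K i) (extra j)) (rows j i)
    vertex-adj N rows (extraₛ j) centreₛ = outside-centre-nonadjacent K (extra-outside j)
    vertex-adj N rows (extraₛ j) (leafₛ i) = rows j i
    vertex-adj N rows (extraₛ j) (extraₛ k) = outsiders-nonadjacent K (extra-outside j) (extra-outside k)

    iso-via-extendedClaw : (∀ w → Outside K w → ∃ λ j → extra j ≡ w) →
      (N : Fin p → Fin 3 → Bool) → (∀ j i → adj G (extra j) (leaf K i) ≡ N j i) →
      ∀ {k} {H : Graph k} → Iso (extendedClaw N) H → Iso G H
    iso-via-extendedClaw extra-covers N rows {H = H} = iso-trans {G = G} {A = extendedClaw N} {B = H}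
      (iso-of-enumeration {G = G} {A = extendedClaw N} (vertex ∘ slot)
        (λ eq → trans (sym (unslot-slot _)) (trans (cong unslot (vertex-injective eq)) (unslot-slot _)))
        covers (λ i j → vertex-adj N rows (slot i) (slot j)))
      where
      slot-covers : ∀ w → ∃ λ s → vertex s ≡ w
      slot-covers w with inClaw? K w
      ... | yes (inj₁ refl) = centreₛ , refl
      ... | yes (inj₂ (i , refl)) = leafₛ i , refl
      ... | no w-out = extraₛ (proj₁ (extra-covers w w-out)) , proj₂ (extra-covers w w-out)
      covers : ∀ w → ∃ λ i → vertex (slot i) ≡ w
      covers w with slot-covers w
      ... | s , eq = unslot s , trans (cong vertex (slot-unslot s)) eq

  outsider-kind : (K : Claw G) → ∀ {x} → Outside K x →
    (∀ i → E G x (leaf K i)) ⊎ ∃ λ i → adj G x (leaf K i) ≡ false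
  outsider-kind K {x} x-out with all? (λ i → adj G x (leaf K i) Bool.≟ true)
  ... | yes sees-all = inj₁ sees-all
  ... | no ¬sees-all =
    inj₂ (Product.map₂ ¬-not (¬∀⟶∃¬ 3 _ (λ i → adj G x (leaf K i) Bool.≟ true) ¬sees-all))

  row-allLeavesBut : (K : Claw G) → ∀ {x i} → Outside K x → adj G x (leaf K i) ≡ false →
    ∀ t → adj G x (leaf K t) ≡ allLeavesBut i t
  row-allLeavesBut K {i = i} x-out xi t with t ≟ i
  ... | yes refl = xi
  ... | no t≢i = outsider-misses-only K x-out xi t t≢i

  one-outsider : (K : Claw G) → ∀ {x} → Outside K x → (∀ w → Outside K w → w ≡ x) → Exceptional G
  one-outsider K {x} x-out only-x with outsider-kind K x-out
  ... | inj₁ x-sees-all = is-K23 (iso-via-extendedClaw K (x ∷ []) single-injective (λ { zero → x-out })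
    covers (everyLeaf ∷ []) (λ { zero → x-sees-all }) {H = K23} K23≅)
    where
    covers : ∀ w → Outside K w → ∃ λ j → (x ∷ []) j ≡ w
    covers w w-out = zero , sym (only-x w w-out)
  ... | inj₂ (i , xi) = is-exc4 (iso-via-extendedClaw K′ (x ∷ []) single-injective (λ { zero → x-out′ })
    covers (allLeavesBut zero ∷ []) (λ { zero → row-allLeavesBut K′ x-out′ xi }) {H = exc4} exc4≅)
    where
    K′ = relabel (transpose zero i) K
    x-out′ : Outside K′ x
    x-out′ = outside-relabel (transpose zero i) K x-out
    covers : ∀ w → Outside K′ w → ∃ λ j → (x ∷ []) j ≡ w
    covers w w-out = zero , sym (only-x w (outside-of-relabel (transpose zero i) K w-out))

  module _ (K : Claw G) {x y} (x≢y : x ≢ y) (only-x-y : ∀ w → Outside K w → w ≡ x ⊎ w ≡ y) where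

    private
      covers : ∀ {K′ : Claw G} → (∀ {w} → Outside K′ w → Outside K w) →
               ∀ w → Outside K′ w → ∃ λ j → (x ∷ y ∷ []) j ≡ w
      covers outside w w-out with only-x-y w (outside w-out)
      ... | inj₁ w≡x = zero , sym w≡x
      ... | inj₂ w≡y = suc zero , sym w≡y

    two-full-outsiders : Outside K x → Outside K y →
      (∀ i → E G x (leaf K i)) → (∀ i → E G y (leaf K i)) → Iso G K33
    two-full-outsiders x-out y-out x-sees-all y-sees-all =
      iso-via-extendedClaw K (x ∷ y ∷ []) (pair-injective x≢y) (λ { zero → x-out ; (suc zero) → y-out })
        (covers {K} (λ w-out → w-out)) (everyLeaf ∷ everyLeaf ∷ [])
        (λ { zero → x-sees-all ; (suc zero) → y-sees-all })
        {H = K33} K33≅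

    full-and-partial-outsider : ∀ {i} → Outside K x → Outside K y → (∀ i → E G x (leaf K i)) →
      adj G y (leaf K i) ≡ false → Iso G exc6
    full-and-partial-outsider {i} x-out y-out x-sees-all yi =
      iso-via-extendedClaw K′ (x ∷ y ∷ []) (pair-injective x≢y)
        (λ { zero → x-out′ ; (suc zero) → y-out′ })
        (covers {K′} (outside-of-relabel π K)) (everyLeaf ∷ allLeavesBut zero ∷ [])
        (λ { zero → x-sees-all ∘ (π ⟨$⟩ʳ_) ; (suc zero) → row-allLeavesBut K′ y-out′ yi })
        {H = exc6} exc6≅
      where
      π = transpose zero i
      K′ = relabel π K
      x-out′ : Outside K′ x
      x-out′ = outside-relabel π K x-out
      y-out′ : Outside K′ y
      y-out′ = outside-relabel π K y-out

    two-partial-outsiders : ∀ {i j} → Outside K x → Outside K y → i ≢ j →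
      adj G x (leaf K i) ≡ false → adj G y (leaf K j) ≡ false → Iso G exc5
    two-partial-outsiders {i} {j} x-out y-out i≢j xi yj with permutation-sending i j i≢j
    ... | π , π0≡i , π2≡j =
      iso-via-extendedClaw K′ (x ∷ y ∷ []) (pair-injective x≢y)
        (λ { zero → x-out′ ; (suc zero) → y-out′ })
        (covers {K′} (outside-of-relabel π K)) (allLeavesBut zero ∷ allLeavesBut (# 2) ∷ [])
        (λ { zero → row-allLeavesBut K′ x-out′ (subst (λ t → adj G x (leaf K t) ≡ false) (sym π0≡i) xi)
           ; (suc zero) →
               row-allLeavesBut K′ y-out′ (subst (λ t → adj G y (leaf K t) ≡ false) (sym π2≡j) yj) })
        {H = exc5} exc5≅
      where
      K′ = relabel π K
      x-out′ : Outside K′ x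
      x-out′ = outside-relabel π K x-out
      y-out′ : Outside K′ y
      y-out′ = outside-relabel π K y-out

  two-outsiders : (K : Claw G) → ∀ {x y} → Outside K x → Outside K y → x ≢ y →
    (∀ w → Outside K w → w ≡ x ⊎ w ≡ y) → Exceptional G
  two-outsiders K x-out y-out x≢y only-x-y with outsider-kind K x-out | outsider-kind K y-out
  ... | inj₁ x-sees-all | inj₁ y-sees-all =
    is-K33 (two-full-outsiders K x≢y only-x-y x-out y-out x-sees-all y-sees-all)
  ... | inj₁ x-sees-all | inj₂ (_ , yi) =
    is-exc6 (full-and-partial-outsider K x≢y only-x-y x-out y-out x-sees-all yi)
  ... | inj₂ (_ , xi) | inj₁ y-sees-all =
    is-exc6 (full-and-partial-outsider K (x≢y ∘ sym) (λ w → Sum.swap ∘ only-x-y w)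
               y-out x-out y-sees-all xi)
  ... | inj₂ (i , xi) | inj₂ (j , yj) with i ≟ j
  ...   | yes refl = ⊥-elim (no-common-miss K x-out y-out x≢y xi yj)
  ...   | no i≢j = is-exc5 (two-partial-outsiders K x≢y only-x-y x-out y-out i≢j xi yj)

  exceptional : Claw G → Exceptional G
  exceptional K with any? (λ w → ¬? (inClaw? K w))
  ... | no no-outsider = is-claw (iso-via-extendedClaw K [] (λ {}) (λ ())
    (λ w w-out → ⊥-elim (no-outsider (w , w-out))) [] (λ ()) {H = claw} claw≅)
  ... | yes (x , x-out) with any? (λ w → ¬? (inClaw? K w) ×-dec ¬? (w ≟ x))
  ...   | no only-x = one-outsider K x-out λ w w-out →
    decidable-stable (w ≟ x) (λ w≢x → only-x (w , w-out , w≢x))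
  ...   | yes (y , y-out , y≢x) = two-outsiders K x-out y-out (y≢x ∘ sym) only-x-y
    where
    only-x-y : ∀ w → Outside K w → w ≡ x ⊎ w ≡ y
    only-x-y w w-out with w ≟ x | w ≟ y
    ... | yes w≡x | _ = inj₁ w≡x
    ... | no _ | yes w≡y = inj₂ w≡y
    ... | no w≢x | no w≢y = ⊥-elim (at-most-two-outsiders K x-out y-out w-out (y≢x ∘ sym) w≢x w≢y)

theorem19 : ∀ {n} (G : Graph n) → NoIsolated G → Free bull G →
    ¬ Iso G claw → ¬ Iso G K23 → ¬ Iso G K33 →
    ¬ Iso G exc4 → ¬ Iso G exc5 → ¬ Iso G exc6 →
    ClawFree G ⇔' AllContractionsClawFree G
theorem19 {zero} G _ _ _ _ _ _ _ _ = (λ _ → tt) , (λ _ (f , _) → ¬Fin0 (f zero))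
theorem19 {suc m} G no-isolated bull-free ¬claw ¬K23 ¬K33 ¬exc4 ¬exc5 ¬exc6 =
  (λ claw-free → contraction-claw-free {G = G} claw-free bull-free) ,
  (λ contractions-claw-free →
    not-exceptional ∘ Backward.exceptional no-isolated contractions-claw-free ∘ induced⇒claw)
  where
  not-exceptional : ¬ Exceptional G
  not-exceptional (is-claw iso) = ¬claw iso
  not-exceptional (is-K23 iso) = ¬K23 iso
  not-exceptional (is-K33 iso) = ¬K33 iso
  not-exceptional (is-exc4 iso) = ¬exc4 iso
  not-exceptional (is-exc5 iso) = ¬exc5 iso
  not-exceptional (is-exc6 iso) = ¬exc6 iso
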